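{- Let $n$ be a positive integer with $\gcd(n,6)=1$ and let $S=(x_1)(x_2)(x_3)(x_4)$ be a minimal zero-sum sequence over $\mathbb{Z}/n$ with integers $1\le x_i<n$. Suppose $\mathrm{ind}(S)=2$. Then (i) for every $g\in(\mathbb{Z}/n)^*$ we have $\#\{i:(x_ig)_n>\frac{n}{2}\}=2$; (ii) if in addition $\gcd(x_i,n)=1$ for all $i$, then $x_1,x_2,x_3,x_4$ are pairwise distinct.
   Context: $(x)_n$ denotes the least nonnegative residue of $x$ modulo $n$. A sequence is minimal zero-sum if its terms sum to $0$ and no proper nontrivial subsequence sums to $0$. For a generator $g$ of $\mathbb{Z}/n$, writing $S=(y_1g)\cdots(y_4g)$ with $1\le y_i\le n$, the $g$-norm is $\|S\|_g=\frac{1}{n}\sum y_i$, and $\mathrm{ind}(S)=\min_g\|S\|_g$ over all generators $g$. -}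

module Defs where

open import Data.Nat using (ℕ; NonZero; _+_; _*_; _≤_; _<_; _≥_; _%_; _>_; _≟_; _<?_)
open import Data.Nat.Divisibility using (_∣_)
open import Data.Nat.Coprimality using (Coprime)
open import Data.Fin using (Fin)
open import Data.Fin.Subset using (Subset; _∈_; Nonempty; ⊤)
open import Data.List using (List; map; allFin; filter; length)
open import Data.Nat.ListAction using (sum)
open import Data.Product using (Σ; _×_; ∃)
open import Relation.Binary.PropositionalEquality using (_≡_; _≢_)
open import Relation.Nullary using (¬_; Dec; yes; no)
open import Data.Fin.Subset.Properties using (_∈?_)

-- A sequence of length 4 over ℤ/n, each term represented by an integer.
Seq4 : Set
Seq4 = Fin 4 → ℕ

total : Seq4 → ℕ
total x = sum (map x (allFin 4))

subSum : Seq4 → Subset 4 → ℕ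
subSum x s = sum (map x (filter (λ i → i ∈? s) (allFin 4)))

_≡[_]_ : ℕ → (n : ℕ) → .{{NonZero n}} → ℕ → Set
a ≡[ n ] b = a % n ≡ b % n

MinimalZeroSum : (n : ℕ) → Seq4 → Set
MinimalZeroSum n x =
  (n ∣ total x) ×
  (∀ (s : Subset 4) → Nonempty s → s ≢ ⊤ → ¬ (n ∣ subSum x s))

Generator : ℕ → ℕ → Set
Generator n g = (g < n) × Coprime g n

-- ys is the coefficient vector of S = (y_1 g)...(y_4 g) with 1 ≤ y_i ≤ n,
-- i.e. y_i g ≡ x_i (mod n).
Coeffs : (n : ℕ) → .{{NonZero n}} → ℕ → Seq4 → Seq4 → Set
Coeffs n g x y = ∀ i → (1 ≤ y i) × (y i ≤ n) × ((y i * g) ≡[ n ] x i)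

-- ‖S‖_g = (Σ y_i)/n.  ind(S) = k  iff  min over generators g of (Σ y_i)/n is k,
-- i.e. some generator attains Σ y_i = k n and every generator gives Σ y_i ≥ k n.
-- (The y_i are uniquely determined by g, so quantifying over them is harmless.)
IndEq : (n : ℕ) → .{{NonZero n}} → Seq4 → ℕ → Set
IndEq n x k =
  (Σ ℕ λ g → Generator n g × Σ Seq4 λ y → Coeffs n g x y × total y ≡ k * n) ×
  (∀ g → Generator n g → ∀ y → Coeffs n g x y → total y ≥ k * n)


countBig : (n : ℕ) → .{{NonZero n}} → ℕ → Seq4 → ℕ
countBig n g x = length (filter (λ i → n <? 2 * ((x i * g) % n)) (allFin 4))

module Submission where

-- For a unit u modulo n let S·u be the sequence of residues (xᵢu)ₙ.  If g is
-- the residue of u⁻¹ then these residues are exactly the coefficients yᵢ of S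
-- with respect to the generator g, so ind(S) = 2 gives total(S·u) ≥ 2n for
-- every unit u.  Since (xᵢu)ₙ + (xᵢ(-u))ₙ = n for each i, the totals for u and
-- -u add up to 4n, hence total(S·u) = 2n for every unit u (scale-total).
--  (i)  As n is odd, 2 is a unit and (2y)ₙ = 2y - n·[2y > n] for 0 ≤ y < n.
--       Summing over the four terms, total(S·2g) = 2·total(S·g) - n·count,
--       i.e. 2n = 4n - n·count, so count = 2.
--  (ii) If xᵢ = xⱼ is a unit, scaling by v = xᵢ⁻¹ gives a sequence with two
--       terms equal to 1, all terms below n and total 2n; the other two terms
--       are then n - 1, so some two-term subsequence sums to n.  Scaling back
--       by xᵢ yields a proper zero-sum subsequence of S, contradicting
--       minimality.
-- Only gcd(n,2) = 1 is used.

open import Defs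
open import Data.Nat
open import Data.Nat.Properties
open import Data.Nat.DivMod
open import Data.Nat.Divisibility
open import Data.Nat.GCD using (gcd; gcd-greatest; module Bézout)
open import Data.Nat.Coprimality using (Coprime; coprime-Bézout)
open import Data.Nat.Tactic.RingSolver using (solve-∀)
open import Data.Nat.ListAction using (sum)
open import Algebra.Properties.CommutativeSemigroup +-commutativeSemigroup
  using (interchange; x∙yz≈y∙xz)
open import Data.Fin using (zero; suc)
open import Data.Fin.Subset using (Subset; Nonempty; ⊤)
open import Data.Fin.Subset.Properties using (_∈?_)
open import Data.Vec using (_∷_; []; here)
open import Data.Bool using (true; false)
open import Data.List using ([]; _∷_; map; filter; length; allFin)
open import Data.List.Properties using (filter-accept; filter-reject; map-cong)
open import Data.Product using (Σ; _×_; _,_; proj₁; proj₂)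
open import Data.Sum using (inj₁; inj₂)
open import Relation.Nullary using (¬_; yes; no; contradiction)
open import Relation.Binary.PropositionalEquality
open import Function using (flip)

sum-complementary : ∀ {A : Set} (y z : A → ℕ) (c : ℕ) → (∀ a → y a + z a ≡ c) →
  ∀ l → sum (map y l) + sum (map z l) ≡ length l * c
sum-complementary y z c y+z≡c [] = refl
sum-complementary y z c y+z≡c (a ∷ l) = begin
  (y a + sum (map y l)) + (z a + sum (map z l))
    ≡⟨ interchange (y a) _ (z a) _ ⟩
  (y a + z a) + (sum (map y l) + sum (map z l))
    ≡⟨ cong₂ _+_ (y+z≡c a) (sum-complementary y z c y+z≡c l) ⟩
  c + length l * c ∎
  where open ≡-Reasoning

multiple-between-0-and-2n : ∀ {n t} → 0 < t → t < n + n → n ∣ t → t ≡ n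
multiple-between-0-and-2n 0<t _ (divides zero refl) = contradiction 0<t (λ ())
multiple-between-0-and-2n {n} _ _ (divides (suc zero) refl) = +-identityʳ n
multiple-between-0-and-2n {n} _ t<2n (divides (suc (suc q)) refl) =
  contradiction t<2n (≤⇒≯ (+-monoʳ-≤ n (m≤m+n n (q * n))))

module Residues (n : ℕ) .{{_ : NonZero n}} (1<n : 1 < n) where

  -- n written as a successor, so that n - 1 is available as -1.
  n-1 : ℕ
  n-1 = pred n

  1+n-1≡n : suc n-1 ≡ n
  1+n-1≡n = suc-pred n

  residue-of-1+kn : ∀ k → (1 + k * n) % n ≡ 1
  residue-of-1+kn k = trans ([m+kn]%n≡m%n 1 k n) (m<n⇒m%n≡m 1<n)

  %-absorbˡ : ∀ a b → ((a % n) * b) % n ≡ (a * b) % n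
  %-absorbˡ a b = begin
    ((a % n) * b) % n            ≡⟨ %-distribˡ-* (a % n) b n ⟩
    (a % n % n * (b % n)) % n    ≡⟨ cong (λ t → (t * (b % n)) % n) (m%n%n≡m%n a n) ⟩
    (a % n * (b % n)) % n        ≡⟨ %-distribˡ-* a b n ⟨
    (a * b) % n                  ∎
    where open ≡-Reasoning

  %-absorbʳ : ∀ a b → (a * (b % n)) % n ≡ (a * b) % n
  %-absorbʳ a b = begin
    (a * (b % n)) % n  ≡⟨ cong (_% n) (*-comm a (b % n)) ⟩
    ((b % n) * a) % n  ≡⟨ %-absorbˡ b a ⟩
    (b * a) % n        ≡⟨ cong (_% n) (*-comm b a) ⟩
    (a * b) % n        ∎
    where open ≡-Reasoning

  IsInverse : ℕ → ℕ → Set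
  IsInverse u v = (u * v) % n ≡ 1

  Invertible : ℕ → Set
  Invertible u = Σ ℕ (IsInverse u)

  cancel-inverse : ∀ {u v} a → IsInverse u v → ((a * u) % n * v) % n ≡ a % n
  cancel-inverse {u} {v} a uv≡1 = begin
    ((a * u) % n * v) % n  ≡⟨ %-absorbˡ (a * u) v ⟩
    (a * u * v) % n        ≡⟨ cong (_% n) (*-assoc a u v) ⟩
    (a * (u * v)) % n      ≡⟨ %-absorbʳ a (u * v) ⟨
    (a * ((u * v) % n)) % n ≡⟨ cong (λ t → (a * t) % n) uv≡1 ⟩
    (a * 1) % n            ≡⟨ cong (_% n) (*-identityʳ a) ⟩
    a % n                  ∎
    where open ≡-Reasoning

  nonzero-residue : ∀ {u v a} → 0 < a → a < n → IsInverse u v → 0 < (a * u) % n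
  nonzero-residue {u} {v} {a} 0<a a<n uv≡1 = n≢0⇒n>0 λ au≡0 → <⇒≢ 0<a (sym (begin
    a                      ≡⟨ m<n⇒m%n≡m a<n ⟨
    a % n                  ≡⟨ cancel-inverse a uv≡1 ⟨
    ((a * u) % n * v) % n  ≡⟨ cong (λ t → (t * v) % n) au≡0 ⟩
    0 % n                  ≡⟨ m*n%n≡0 0 n ⟩
    0                      ∎))
    where open ≡-Reasoning

  invertible-* : ∀ {a b} → Invertible a → Invertible b → Invertible (a * b)
  invertible-* {a} {b} (a⁻¹ , aa⁻¹≡1) (b⁻¹ , bb⁻¹≡1) = a⁻¹ * b⁻¹ , (begin
    (a * b * (a⁻¹ * b⁻¹)) % n        ≡⟨ cong (_% n) (regroup a b a⁻¹ b⁻¹) ⟩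
    ((a * a⁻¹) * (b * b⁻¹)) % n      ≡⟨ %-absorbˡ (a * a⁻¹) (b * b⁻¹) ⟨
    ((a * a⁻¹) % n * (b * b⁻¹)) % n  ≡⟨ cong (λ t → (t * (b * b⁻¹)) % n) aa⁻¹≡1 ⟩
    (1 * (b * b⁻¹)) % n              ≡⟨ cong (_% n) (*-identityˡ (b * b⁻¹)) ⟩
    (b * b⁻¹) % n                    ≡⟨ bb⁻¹≡1 ⟩
    1                                ∎)
    where
    open ≡-Reasoning
    regroup : ∀ a b c d → a * b * (c * d) ≡ (a * c) * (b * d)
    regroup = solve-∀

  -- n - 1 represents -1, which is its own inverse: (n-1)² + n = 1 + (n-1)·n.
  invertible-n-1 : Invertible n-1
  invertible-n-1 = n-1 , (begin
    (n-1 * n-1) % n            ≡⟨ [m+n]%n≡m%n (n-1 * n-1) n ⟨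
    (n-1 * n-1 + n) % n        ≡⟨ cong (λ t → (n-1 * n-1 + t) % n) 1+n-1≡n ⟨
    (n-1 * n-1 + suc n-1) % n  ≡⟨ cong (_% n) (square-identity n-1) ⟩
    (1 + n-1 * suc n-1) % n    ≡⟨ cong (λ t → (1 + n-1 * t) % n) 1+n-1≡n ⟩
    (1 + n-1 * n) % n          ≡⟨ residue-of-1+kn n-1 ⟩
    1                          ∎)
    where
    open ≡-Reasoning
    square-identity : ∀ k → k * k + suc k ≡ 1 + k * suc k
    square-identity = solve-∀

  -- Bézout: numbers coprime to n are invertible.  In the case xu ≡ -1 the
  -- inverse is -x = x·(n-1).
  coprime⇒invertible : ∀ {u} → Coprime u n → Invertible u
  coprime⇒invertible {u} u⊥n with coprime-Bézout u⊥n
  ... | Bézout.+- x y 1+yn≡xu = x , (begin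
    (u * x) % n      ≡⟨ cong (_% n) (*-comm u x) ⟩
    (x * u) % n      ≡⟨ cong (_% n) 1+yn≡xu ⟨
    (1 + y * n) % n  ≡⟨ residue-of-1+kn y ⟩
    1                ∎)
    where open ≡-Reasoning
  ... | Bézout.-+ x y 1+xu≡yn = x * n-1 , (begin
    (u * (x * n-1)) % n          ≡⟨ [m+n]%n≡m%n (u * (x * n-1)) n ⟨
    (u * (x * n-1) + n) % n      ≡⟨ cong (λ t → (u * (x * n-1) + t) % n) 1+n-1≡n ⟨
    (u * (x * n-1) + suc n-1) % n ≡⟨ cong (_% n) (negate-twice u x n-1) ⟩
    ((1 + x * u) * n-1 + 1) % n  ≡⟨ cong (λ t → (t * n-1 + 1) % n) 1+xu≡yn ⟩
    (y * n * n-1 + 1) % n        ≡⟨ cong (_% n) (multiple-plus-1 y n n-1) ⟩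
    (1 + (y * n-1) * n) % n      ≡⟨ residue-of-1+kn (y * n-1) ⟩
    1                            ∎)
    where
    open ≡-Reasoning
    negate-twice : ∀ u x k → u * (x * k) + suc k ≡ (1 + x * u) * k + 1
    negate-twice = solve-∀
    multiple-plus-1 : ∀ y m k → y * m * k + 1 ≡ 1 + (y * k) * m
    multiple-plus-1 = solve-∀

  -- The residue of an inverse is coprime to n: a common divisor of v % n and
  -- n divides v, hence u·v, hence (u·v) % n = 1.
  inverse-coprime : ∀ {u v} → IsInverse u v → Coprime (v % n) n
  inverse-coprime {u} {v} uv≡1 {d} (d∣v%n , d∣n) =
    ∣1⇒≡1 (subst (d ∣_) uv≡1 (%-presˡ-∣ d∣uv d∣n))
    where
    d∣uv : d ∣ u * v
    d∣uv = ∣-trans (∣n∣m%n⇒∣m d∣n d∣v%n) (n∣m*n u)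

  -- For odd n and 0 ≤ y < n, doubling modulo n subtracts n exactly when 2y > n
  -- (2y = n is impossible).
  doubled-residue : ¬ 2 ∣ n → ∀ {y} → y < n →
    (n < 2 * y → (2 * y) % n + n ≡ 2 * y) × (¬ n < 2 * y → (2 * y) % n ≡ 2 * y)
  doubled-residue n-odd {y} y<n = wraps , stays
    where
    wraps : n < 2 * y → (2 * y) % n + n ≡ 2 * y
    wraps n<2y = begin
      (2 * y) % n + n        ≡⟨ cong (_+ n) (m≤n⇒[n∸m]%m≡n%m (<⇒≤ n<2y)) ⟨
      (2 * y ∸ n) % n + n    ≡⟨ cong (_+ n) (m<n⇒m%n≡m 2y-n<n) ⟩
      2 * y ∸ n + n          ≡⟨ m∸n+n≡m (<⇒≤ n<2y) ⟩
      2 * y                  ∎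
      where
      open ≡-Reasoning
      2y-n<n : 2 * y ∸ n < n
      2y-n<n = +-cancelʳ-< n (2 * y ∸ n) n
        (subst (_< n + n) (sym (m∸n+n≡m (<⇒≤ n<2y)))
          (subst (_< n + n) (sym (cong (y +_) (+-identityʳ y))) (+-mono-< y<n y<n)))
    stays : ¬ n < 2 * y → (2 * y) % n ≡ 2 * y
    stays n≮2y = m<n⇒m%n≡m (≤∧≢⇒< (≮⇒≥ n≮2y) λ 2y≡n →
      n-odd (divides y (trans (sym 2y≡n) (*-comm 2 y))))

  -- Summing doubled residues: each term with 2y > n loses exactly one n, so
  -- #{a : 2y_a > n}·n + Σ (2y_a)ₙ = 2·Σ y_a.
  sum-doubled-residues : ¬ 2 ∣ n → ∀ {A : Set} (y : A → ℕ) → (∀ a → y a < n) →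
    ∀ l → length (filter (λ a → n <? 2 * y a) l) * n
          + sum (map (λ a → (2 * y a) % n) l) ≡ 2 * sum (map y l)
  sum-doubled-residues n-odd y y<n [] = refl
  sum-doubled-residues n-odd y y<n (a ∷ l) with n <? 2 * y a
  ... | yes n<2ya rewrite filter-accept (λ b → n <? 2 * y b) {a} {l} n<2ya = begin
    (n + count * n) + ((2 * y a) % n + rest)  ≡⟨ interchange n _ _ rest ⟩
    (n + (2 * y a) % n) + (count * n + rest)  ≡⟨ cong (_+ (count * n + rest)) (+-comm n _) ⟩
    ((2 * y a) % n + n) + (count * n + rest)  ≡⟨ cong₂ _+_ (proj₁ (doubled-residue n-odd (y<n a)) n<2ya)
                                                       (sum-doubled-residues n-odd y y<n l) ⟩
    2 * y a + 2 * sum (map y l)               ≡⟨ *-distribˡ-+ 2 (y a) _ ⟨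
    2 * (y a + sum (map y l))                 ∎
    where
    open ≡-Reasoning
    count rest : ℕ
    count = length (filter (λ b → n <? 2 * y b) l)
    rest = sum (map (λ b → (2 * y b) % n) l)
  ... | no n≮2ya rewrite filter-reject (λ b → n <? 2 * y b) {a} {l} n≮2ya = begin
    count * n + ((2 * y a) % n + rest)  ≡⟨ x∙yz≈y∙xz (count * n) _ rest ⟩
    (2 * y a) % n + (count * n + rest)  ≡⟨ cong₂ _+_ (proj₂ (doubled-residue n-odd (y<n a)) n≮2ya)
                                                 (sum-doubled-residues n-odd y y<n l) ⟩
    2 * y a + 2 * sum (map y l)         ≡⟨ *-distribˡ-+ 2 (y a) _ ⟨
    2 * (y a + sum (map y l))           ∎
    where
    open ≡-Reasoning
    count rest : ℕ
    count = length (filter (λ b → n <? 2 * y b) l)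
    rest = sum (map (λ b → (2 * y b) % n) l)

  sum-scaled : ∀ {A : Set} (y : A → ℕ) u l →
    (sum (map y l) * u) % n ≡ sum (map (λ a → (y a * u) % n) l) % n
  sum-scaled y u [] = refl
  sum-scaled y u (a ∷ l) = begin
    ((y a + Y) * u) % n              ≡⟨ cong (_% n) (*-distribʳ-+ u (y a) Y) ⟩
    (y a * u + Y * u) % n            ≡⟨ %-distribˡ-+ (y a * u) (Y * u) n ⟩
    ((y a * u) % n + (Y * u) % n) % n ≡⟨ cong (λ t → ((y a * u) % n + t) % n) (sum-scaled y u l) ⟩
    ((y a * u) % n + Z % n) % n      ≡⟨ cong (λ t → (t + Z % n) % n) (m%n%n≡m%n (y a * u) n) ⟨
    ((y a * u) % n % n + Z % n) % n  ≡⟨ %-distribˡ-+ ((y a * u) % n) Z n ⟨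
    ((y a * u) % n + Z) % n          ∎
    where
    open ≡-Reasoning
    Y Z : ℕ
    Y = sum (map y l)
    Z = sum (map (λ b → (y b * u) % n) l)

ProperSubsumEqualTo : ℕ → Seq4 → Set
ProperSubsumEqualTo n y = Σ (Subset 4) λ s → Nonempty s × s ≢ ⊤ × subSum y s ≡ n

pattern i₀ = zero
pattern i₁ = suc zero
pattern i₂ = suc (suc zero)
pattern i₃ = suc (suc (suc zero))

-- Four numbers below n summing to 2n, two of which equal 1: the others are
-- n - 1, so each of them together with a 1 sums to n.
ones-pair-to-n : ∀ {n a b c d} → a ≡ 1 → b ≡ 1 → c < n → d < n →
  a + b + c + d ≡ 2 * n → a + c ≡ n
ones-pair-to-n {n} {c = c} {d} refl refl c<n d<n total≡2n with m≤n⇒m<n∨m≡n c<n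
... | inj₂ 1+c≡n = 1+c≡n
... | inj₁ 1+c<n = contradiction total≡2n (<⇒≢ (begin-strict
  1 + 1 + c + d      ≡⟨ +-suc (suc c) d ⟨
  suc c + suc d      <⟨ +-mono-<-≤ 1+c<n d<n ⟩
  n + n              ≡⟨ cong (n +_) (+-identityʳ n) ⟨
  2 * n              ∎))
  where open ≤-Reasoning

two-ones⇒pair-sum-n : ∀ {n} (y : Seq4) → (∀ k → y k < n) → total y ≡ 2 * n →
  ∀ i j → i ≢ j → y i ≡ 1 → y j ≡ 1 → ProperSubsumEqualTo n y
two-ones⇒pair-sum-n {n} y y<n total≡2n = pair
  where
  y₀ y₁ y₂ y₃ : ℕ
  y₀ = y i₀
  y₁ = y i₁
  y₂ = y i₂
  y₃ = y i₃

  s₀₁ s₀₂ : Subset 4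
  s₀₁ = true ∷ true ∷ false ∷ false ∷ []
  s₀₂ = true ∷ false ∷ true ∷ false ∷ []

  rearrange : ∀ {t} → y₀ + (y₁ + (y₂ + (y₃ + 0))) ≡ t → t ≡ 2 * n
  rearrange y≡t = trans (sym y≡t) total≡2n

  as-0123 : ∀ a b c d → a + (b + (c + (d + 0))) ≡ a + b + c + d
  as-0123 = solve-∀
  as-0213 : ∀ a b c d → a + (b + (c + (d + 0))) ≡ a + c + b + d
  as-0213 = solve-∀
  as-0312 : ∀ a b c d → a + (b + (c + (d + 0))) ≡ a + d + b + c
  as-0312 = solve-∀
  as-1203 : ∀ a b c d → a + (b + (c + (d + 0))) ≡ b + c + a + d
  as-1203 = solve-∀
  as-1302 : ∀ a b c d → a + (b + (c + (d + 0))) ≡ b + d + a + c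
  as-1302 = solve-∀
  as-2301 : ∀ a b c d → a + (b + (c + (d + 0))) ≡ c + d + a + b
  as-2301 = solve-∀

  via-s₀₁ : y₀ + y₁ ≡ n → ProperSubsumEqualTo n y
  via-s₀₁ sum≡n = s₀₁ , (zero , here) , (λ ()) , trans (cong (y₀ +_) (+-identityʳ y₁)) sum≡n

  via-s₀₂ : y₀ + y₂ ≡ n → ProperSubsumEqualTo n y
  via-s₀₂ sum≡n = s₀₂ , (zero , here) , (λ ()) , trans (cong (y₀ +_) (+-identityʳ y₂)) sum≡n

  ones-at-01 : y₀ ≡ 1 → y₁ ≡ 1 → ProperSubsumEqualTo n y
  ones-at-01 y₀≡1 y₁≡1 = via-s₀₂
    (ones-pair-to-n y₀≡1 y₁≡1 (y<n i₂) (y<n i₃) (rearrange (as-0123 y₀ y₁ y₂ y₃)))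

  ones-at-02 : y₀ ≡ 1 → y₂ ≡ 1 → ProperSubsumEqualTo n y
  ones-at-02 y₀≡1 y₂≡1 = via-s₀₁
    (ones-pair-to-n y₀≡1 y₂≡1 (y<n i₁) (y<n i₃) (rearrange (as-0213 y₀ y₁ y₂ y₃)))

  ones-at-03 : y₀ ≡ 1 → y₃ ≡ 1 → ProperSubsumEqualTo n y
  ones-at-03 y₀≡1 y₃≡1 = via-s₀₁
    (ones-pair-to-n y₀≡1 y₃≡1 (y<n i₁) (y<n i₂) (rearrange (as-0312 y₀ y₁ y₂ y₃)))

  ones-at-12 : y₁ ≡ 1 → y₂ ≡ 1 → ProperSubsumEqualTo n y
  ones-at-12 y₁≡1 y₂≡1 = via-s₀₁ (trans (+-comm y₀ y₁)
    (ones-pair-to-n y₁≡1 y₂≡1 (y<n i₀) (y<n i₃) (rearrange (as-1203 y₀ y₁ y₂ y₃))))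

  ones-at-13 : y₁ ≡ 1 → y₃ ≡ 1 → ProperSubsumEqualTo n y
  ones-at-13 y₁≡1 y₃≡1 = via-s₀₁ (trans (+-comm y₀ y₁)
    (ones-pair-to-n y₁≡1 y₃≡1 (y<n i₀) (y<n i₂) (rearrange (as-1302 y₀ y₁ y₂ y₃))))

  ones-at-23 : y₂ ≡ 1 → y₃ ≡ 1 → ProperSubsumEqualTo n y
  ones-at-23 y₂≡1 y₃≡1 = via-s₀₂ (trans (+-comm y₀ y₂)
    (ones-pair-to-n y₂≡1 y₃≡1 (y<n i₀) (y<n i₁) (rearrange (as-2301 y₀ y₁ y₂ y₃))))

  pair : ∀ i j → i ≢ j → y i ≡ 1 → y j ≡ 1 → ProperSubsumEqualTo n y
  pair i₀ i₀ i≢j = contradiction refl i≢j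
  pair i₁ i₁ i≢j = contradiction refl i≢j
  pair i₂ i₂ i≢j = contradiction refl i≢j
  pair i₃ i₃ i≢j = contradiction refl i≢j
  pair i₀ i₁ _ = ones-at-01
  pair i₀ i₂ _ = ones-at-02
  pair i₀ i₃ _ = ones-at-03
  pair i₁ i₂ _ = ones-at-12
  pair i₁ i₃ _ = ones-at-13
  pair i₂ i₃ _ = ones-at-23
  pair i₁ i₀ _ = flip ones-at-01
  pair i₂ i₀ _ = flip ones-at-02
  pair i₃ i₀ _ = flip ones-at-03
  pair i₂ i₁ _ = flip ones-at-12
  pair i₃ i₁ _ = flip ones-at-13
  pair i₃ i₂ _ = flip ones-at-23

gcd[n,6]≡1⇒coprime-2 : ∀ {n} → gcd n 6 ≡ 1 → Coprime 2 n
gcd[n,6]≡1⇒coprime-2 gcd≡1 (d∣2 , d∣n) =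
  ∣1⇒≡1 (subst (_ ∣_) gcd≡1 (gcd-greatest d∣n (∣-trans d∣2 (divides 3 refl))))

coprime-2⇒odd : ∀ {n} → Coprime 2 n → ¬ 2 ∣ n
coprime-2⇒odd 2⊥n 2∣n = contradiction (2⊥n (∣-refl , 2∣n)) λ ()

module ScaledSequences (n : ℕ) .{{_ : NonZero n}} (1<n : 1 < n)
  (x : Seq4) (x-range : ∀ i → 1 ≤ x i × x i < n) where
  open Residues n 1<n

  scale : ℕ → Seq4
  scale u i = (x i * u) % n

  scale-coeffs : ∀ {u v} → IsInverse u v → Coeffs n (v % n) x (scale u)
  scale-coeffs {u} {v} uv≡1 i =
    nonzero-residue (proj₁ (x-range i)) (proj₂ (x-range i)) uv≡1 ,
    <⇒≤ (m%n<n (x i * u) n) ,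
    trans (%-absorbʳ (scale u i) v) (cancel-inverse (x i) uv≡1)

  scale-total-≥ : IndEq n x 2 → ∀ {u} → Invertible u → 2 * n ≤ total (scale u)
  scale-total-≥ ind {u} (v , uv≡1) =
    proj₂ ind (v % n) (m%n<n v n , inverse-coprime {u} uv≡1) (scale u) (scale-coeffs uv≡1)

  scale-negate : ∀ {u} → Invertible u → ∀ i → scale u i + scale (n-1 * u) i ≡ n
  scale-negate {u} (v , uv≡1) i = multiple-between-0-and-2n
    (<-≤-trans (nonzero-residue (proj₁ (x-range i)) (proj₂ (x-range i)) uv≡1) (m≤m+n _ _))
    (+-mono-< (m%n<n (x i * u) n) (m%n<n (x i * (n-1 * u)) n))
    (m%n≡0⇒n∣m _ n (begin
      (scale u i + scale (n-1 * u) i) % n  ≡⟨ %-distribˡ-+ (x i * u) (x i * (n-1 * u)) n ⟨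
      (x i * u + x i * (n-1 * u)) % n      ≡⟨ cong (_% n) (factor-out (x i) u n-1) ⟩
      (x i * u * suc n-1) % n              ≡⟨ cong (λ t → (x i * u * t) % n) 1+n-1≡n ⟩
      (x i * u * n) % n                    ≡⟨ m*n%n≡0 (x i * u) n ⟩
      0                                    ∎))
    where
    open ≡-Reasoning
    factor-out : ∀ a b k → a * b + a * (k * b) ≡ a * b * suc k
    factor-out = solve-∀

  -- Every scaled total is exactly 2n: the totals for u and -u sum to 4n and
  -- are both at least 2n.
  scale-total : IndEq n x 2 → ∀ {u} → Invertible u → total (scale u) ≡ 2 * n
  scale-total ind {u} u-inv = ≤-antisym upper (scale-total-≥ ind u-inv)
    where
    -u-inv : Invertible (n-1 * u)
    -u-inv = invertible-* {n-1} {u} invertible-n-1 u-inv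
    upper : total (scale u) ≤ 2 * n
    upper = +-cancelʳ-≤ (total (scale (n-1 * u))) _ _ (begin
      total (scale u) + total (scale (n-1 * u))
        ≡⟨ sum-complementary (scale u) (scale (n-1 * u)) n (scale-negate u-inv) (allFin 4) ⟩
      4 * n                                  ≡⟨ four≡two+two n ⟩
      2 * n + 2 * n                          ≤⟨ +-monoʳ-≤ (2 * n) (scale-total-≥ ind -u-inv) ⟩
      2 * n + total (scale (n-1 * u))        ∎)
      where
      open ≤-Reasoning
      four≡two+two : ∀ m → 4 * m ≡ 2 * m + 2 * m
      four≡two+two = solve-∀

  scale-zero-sum : ∀ {u v} → IsInverse u v → ∀ s → n ∣ subSum (scale u) s → n ∣ subSum x s
  scale-zero-sum {u} {v} uv≡1 s n∣su = m%n≡0⇒n∣m (subSum x s) n (begin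
    subSum x s % n                    ≡⟨ cancel-inverse (subSum x s) uv≡1 ⟨
    ((subSum x s * u) % n * v) % n    ≡⟨ cong (λ t → (t * v) % n) su%n≡0 ⟩
    (0 * v) % n                       ≡⟨ m*n%n≡0 0 n ⟩
    0                                 ∎)
    where
    open ≡-Reasoning
    su%n≡0 : (subSum x s * u) % n ≡ 0
    su%n≡0 = trans (sum-scaled x u (filter (λ i → i ∈? s) (allFin 4))) (n∣m⇒m%n≡0 _ n n∣su)

  -- Part (i): for odd n, (x_i g)ₙ exceeds n/2 for exactly two indices i.
  -- Comparing the totals for g and 2g: count·n + 2n = 2·2n.
  index-two⇒count-big : IndEq n x 2 → Coprime 2 n → ∀ g → Generator n g → countBig n g x ≡ 2
  index-two⇒count-big ind 2⊥n g (_ , g⊥n) =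
    *-cancelʳ-≡ count 2 n (+-cancelʳ-≡ (2 * n) (count * n) (2 * n) (begin
      count * n + 2 * n                   ≡⟨ cong (count * n +_) (scale-total ind 2g-inv) ⟨
      count * n + total (scale (2 * g))   ≡⟨ cong (λ l → count * n + sum l) (map-cong doubling (allFin 4)) ⟩
      count * n + sum (map (λ i → (2 * scale g i) % n) (allFin 4))
        ≡⟨ sum-doubled-residues (coprime-2⇒odd 2⊥n) (scale g) (λ i → m%n<n (x i * g) n) (allFin 4) ⟩
      2 * total (scale g)                 ≡⟨ cong (2 *_) (scale-total ind g-inv) ⟩
      2 * (2 * n)                         ≡⟨ two-twos n ⟩
      2 * n + 2 * n                       ∎))
    where
    open ≡-Reasoning
    count : ℕ
    count = countBig n g x
    g-inv : Invertible g
    g-inv = coprime⇒invertible g⊥n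
    2g-inv : Invertible (2 * g)
    2g-inv = invertible-* {2} {g} (coprime⇒invertible 2⊥n) g-inv
    regroup : ∀ a b → a * (2 * b) ≡ 2 * (a * b)
    regroup = solve-∀
    doubling : ∀ i → scale (2 * g) i ≡ (2 * scale g i) % n
    doubling i = trans (cong (_% n) (regroup (x i) g)) (sym (%-absorbʳ 2 (x i * g)))
    two-twos : ∀ m → 2 * (2 * m) ≡ 2 * m + 2 * m
    two-twos = solve-∀

  -- Part (ii): two equal unit terms xᵢ = xⱼ become two ones after scaling by
  -- v = xᵢ⁻¹; the resulting pair summing to n pulls back to a proper
  -- zero-sum subsequence of S.
  index-two⇒distinct-units : MinimalZeroSum n x → IndEq n x 2 →
    (∀ i → Coprime (x i) n) → ∀ i j → i ≢ j → x i ≢ x j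
  index-two⇒distinct-units minimal ind x⊥n i j i≢j xᵢ≡xⱼ =
    let (s , nonempty , proper , sum≡n) = pair-summing-to-n in
    proj₂ minimal s nonempty proper
      (scale-zero-sum {v} {x i} vxᵢ≡1 s (subst (n ∣_) (sym sum≡n) ∣-refl))
    where
    v : ℕ
    v = proj₁ (coprime⇒invertible (x⊥n i))
    xᵢv≡1 : IsInverse (x i) v
    xᵢv≡1 = proj₂ (coprime⇒invertible (x⊥n i))
    vxᵢ≡1 : IsInverse v (x i)
    vxᵢ≡1 = trans (cong (_% n) (*-comm v (x i))) xᵢv≡1
    xⱼv≡1 : scale v j ≡ 1
    xⱼv≡1 = trans (cong (λ t → (t * v) % n) (sym xᵢ≡xⱼ)) xᵢv≡1
    pair-summing-to-n : ProperSubsumEqualTo n (scale v)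
    pair-summing-to-n = two-ones⇒pair-sum-n (scale v) (λ k → m%n<n (x k * v) n)
      (scale-total ind (x i , vxᵢ≡1)) i j i≢j xᵢv≡1 xⱼv≡1

lemma2 : (n : ℕ) → .{{_ : NonZero n}} → gcd n 6 ≡ 1 →
    (x : Seq4) → (∀ i → 1 ≤ x i × x i < n) →
    MinimalZeroSum n x → IndEq n x 2 →
    (∀ g → Generator n g → countBig n g x ≡ 2) ×
    ((∀ i → Coprime (x i) n) → ∀ i j → i ≢ j → x i ≢ x j)
lemma2 n gcd≡1 x x-range minimal ind =
  index-two⇒count-big ind (gcd[n,6]≡1⇒coprime-2 gcd≡1) ,
  index-two⇒distinct-units minimal ind
  where
  1<n : 1 < n
  1<n = ≤-<-trans (proj₁ (x-range i₀)) (proj₂ (x-range i₀))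
  open ScaledSequences n 1<n x x-range
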